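{- For every $n\ge 1$, the polynomial $P_n(x,y,z)=\sum_{\sigma\in\mathcal{Q}_n}x^{\mathrm{lap}(\sigma)}y^{\mathrm{dasc}(\sigma)}z^{\mathrm{dp}(\sigma)}$ satisfies $P_n(x,y,z)=P_n(x,z,y)$. Furthermore, $$\sum_{\sigma\in\mathcal{Q}_n}x^{\mathrm{lap}(\sigma)}y^{\mathrm{asc}(\sigma)}=\sum_{\sigma\in\mathcal{Q}_n}x^{\mathrm{lap}(\sigma)}y^{\mathrm{plat}(\sigma)}.$$
   Context: A Stirling permutation of order $n$ is a permutation $\sigma=\sigma_1\cdots\sigma_{2n}$ of the multiset $\{1,1,2,2,\ldots,n,n\}$ such that for each $i$, all entries between the two occurrences of $i$ are larger than $i$; $\mathcal{Q}_n$ is the set of these. Set $\sigma_0=0$. For $1\le i\le 2n-1$: $i$ is a left ascent-plateau if $\sigma_{i-1}<\sigma_i=\sigma_{i+1}$; a double ascent if $\sigma_{i-1}<\sigma_i<\sigma_{i+1}$; a descent-plateau if $\sigma_{i-1}>\sigma_i=\sigma_{i+1}$; $\mathrm{lap}$, $\mathrm{dasc}$, $\mathrm{dp}$ count these. An index $i\in[2n]$ is an ascent of $\sigma$ if $i=1$ or $\sigma_i<\sigma_{i+1}$; $\mathrm{asc}(\sigma)$ is the number of ascents. A plateau is an index $i\in[2n-1]$ with $\sigma_i=\sigma_{i+1}$; $\mathrm{plat}(\sigma)$ is the number of plateaus. -}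

module Defs where

open import Data.Bool using (Bool; true; false; _∧_; _∨_; not)
open import Data.Nat using (ℕ; zero; suc; _+_; _*_; _∸_)
open import Data.Nat.Base using (_≡ᵇ_; _<ᵇ_)
open import Data.List using (List; []; _∷_; length; map; concatMap; applyUpTo; filterᵇ; foldr)

-- Words are lists of naturals.  σ w i is the i-th letter (1-indexed),
-- with the convention σ_0 = 0 (and 0 outside the word, never used
-- inside any statistic below except where noted).

nth : List ℕ → ℕ → ℕ
nth []       _       = 0
nth (x ∷ _)  zero    = x
nth (_ ∷ xs) (suc i) = nth xs i

σ : List ℕ → ℕ → ℕ
σ w zero    = 0
σ w (suc i) = nth w i

[_⋯_] : ℕ → ℕ → List ℕ
[ a ⋯ b ] = applyUpTo (λ k → a + k) (suc b ∸ a)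

allᵇ : {A : Set} → (A → Bool) → List A → Bool
allᵇ p = foldr (λ x b → p x ∧ b) true

#_∈_ : (ℕ → Bool) → List ℕ → ℕ
# p ∈ is = length (filterᵇ p is)

occ : ℕ → List ℕ → ℕ
occ i []       = 0
occ i (x ∷ xs) with i ≡ᵇ x
... | true  = suc (occ i xs)
... | false = occ i xs

isMultisetPerm : ℕ → List ℕ → Bool
isMultisetPerm n w =
  (length w ≡ᵇ 2 * n) ∧ allᵇ (λ i → occ i w ≡ᵇ 2) [ 1 ⋯ n ]

stirlingCond : List ℕ → Bool
stirlingCond w =
  allᵇ (λ p → allᵇ (λ q → allᵇ (λ r →
        not ((p <ᵇ r) ∧ (r <ᵇ q) ∧ (σ w p ≡ᵇ σ w q)) ∨ (σ w p <ᵇ σ w r))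
      [ 1 ⋯ length w ]) [ 1 ⋯ length w ]) [ 1 ⋯ length w ]

isStirling : ℕ → List ℕ → Bool
isStirling n w = isMultisetPerm n w ∧ stirlingCond w

words : ℕ → ℕ → List (List ℕ)
words zero    m = [] ∷ []
words (suc k) m = concatMap (λ x → map (x ∷_) (words k m)) [ 1 ⋯ m ]

-- 𝒬 n : the set of Stirling permutations of order n (as a list,
-- each element occurring exactly once)
𝒬 : ℕ → List (List ℕ)
𝒬 n = filterᵇ (isStirling n) (words (2 * n) n)

-- Statistics (w has length 2n, so 2n = length w).

lap : List ℕ → ℕ
lap w = # (λ i → (σ w (i ∸ 1) <ᵇ σ w i) ∧ (σ w i ≡ᵇ σ w (suc i)))
          ∈ [ 1 ⋯ length w ∸ 1 ]

dasc : List ℕ → ℕ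
dasc w = # (λ i → (σ w (i ∸ 1) <ᵇ σ w i) ∧ (σ w i <ᵇ σ w (suc i)))
           ∈ [ 1 ⋯ length w ∸ 1 ]

dp : List ℕ → ℕ
dp w = # (λ i → (σ w i <ᵇ σ w (i ∸ 1)) ∧ (σ w i ≡ᵇ σ w (suc i)))
         ∈ [ 1 ⋯ length w ∸ 1 ]

asc : List ℕ → ℕ
asc w = # (λ i → (i ≡ᵇ 1) ∨ (σ w (i ∸ 1) <ᵇ σ w i)) ∈ [ 1 ⋯ length w ]

plat : List ℕ → ℕ
plat w = # (λ i → σ w i ≡ᵇ σ w (suc i)) ∈ [ 1 ⋯ length w ∸ 1 ]

-- [x^a y^b z^c] P_n(x,y,z),  P_n = Σ_{σ∈𝒬_n} x^lap y^dasc z^dp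
P-coeff : ℕ → ℕ → ℕ → ℕ → ℕ
P-coeff n a b c =
  length (filterᵇ (λ w → (lap w ≡ᵇ a) ∧ (dasc w ≡ᵇ b) ∧ (dp w ≡ᵇ c)) (𝒬 n))

-- [x^a y^b] Σ_{σ∈𝒬_n} x^lap y^asc
LapAsc-coeff : ℕ → ℕ → ℕ → ℕ
LapAsc-coeff n a b =
  length (filterᵇ (λ w → (lap w ≡ᵇ a) ∧ (asc w ≡ᵇ b)) (𝒬 n))

-- [x^a y^b] Σ_{σ∈𝒬_n} x^lap y^plat
LapPlat-coeff : ℕ → ℕ → ℕ → ℕ
LapPlat-coeff n a b =
  length (filterᵇ (λ w → (lap w ≡ᵇ a) ∧ (plat w ≡ᵇ b)) (𝒬 n))

module Submission where

-- A Stirling word w decomposes as  A · m · B · m · C  with m its least letter and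
-- A, B, C Stirling words above m on pairwise disjoint alphabets; iterating, w is
-- the word of a unique increasing ternary tree (`parse`, `parse-good`, `parse-word`).
-- Exchanging the left and middle subtree at every node (`swap`) therefore induces
-- an involution φ of 𝒬 n.  Each statistic of the theorem counts positions whose
-- letter, compared with its two neighbours, passes a fixed test (`windows`); on the
-- word of an increasing tree such a count is a sum over the nodes of a weight that
-- only depends on which children are empty (`ShapeDetermined`, `windows-tree`).
-- Swapping exchanges the left and middle arguments of the weight, so φ preserves
-- lap, exchanges dasc and dp, and (with the counting identity `rises-vs-plateaus`)
-- sends asc to plat.  The coefficient identities follow by counting through φ
-- (`count-involution`).

open import Defs
open import Data.Bool using (Bool; true; false; T; _∧_; _∨_; not)
open import Data.Bool.Properties using (∧-comm; ∧-zeroʳ; ∧-identityʳ; T-∧)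
open import Data.Nat using (_≟_; ℕ; zero; suc; _+_; _*_; _∸_; _≤_; _<_; s≤s; z≤n; z<s; _<ᵇ_; _≡ᵇ_)
open import Data.Nat.Properties using (n≮0; +-identityʳ; ≤-trans; ≤-antisym; ≤∧≢⇒<; ≤-pred; +-suc; m≤m+n; m≤n+m; n≤1+n; <-irrefl; <⇒<ᵇ; ≡⇒≡ᵇ; +-assoc; +-comm; +-monoʳ-<; m<m+n; <ᵇ⇒<; ≡ᵇ⇒≡; suc-injective; <⇒≢; <-trans; ≤-<-trans; <⇒≤; ≤-refl)
open import Data.Nat.Tactic.RingSolver using (solve-∀)
open import Data.List.Extrema.Nat using (min; min≤⊤; min≤xs; argmin-sel)
open import Data.List.Base using (List; []; _∷_; [_]; _++_; length; map; filterᵇ; applyUpTo; concatMap; cartesianProductWith)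
open import Data.List.Properties using (length-map; ∷-injective; ++-assoc; ++-identityʳ; length-++)
open import Data.List.Membership.Propositional using (_∈_; _∉_)
open import Data.List.Membership.Propositional.Properties
  using (∈-filter⁻; ∈-filter⁺; ∈-map⁺; ∈-map⁻; ∈-cartesianProductWith⁺; ∈-cartesianProductWith⁻;
         ∈-insert; ∈-∃++; ∈-++⁻; ∈-++⁺ˡ; ∈-++⁺ʳ; ∈-applyUpTo⁺; ∈-applyUpTo⁻)
open import Data.List.Membership.Propositional.Properties.WithK using (unique∧set⇒bag)
open import Data.List.Relation.Unary.Any using (here; there)
open import Data.List.Relation.Unary.All as All using (All; []; _∷_)
import Data.List.Relation.Unary.All.Properties as All
open import Data.List.Relation.Unary.AllPairs using ([]; _∷_)
open import Data.List.Relation.Binary.Disjoint.Propositional using (Disjoint)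
import Data.List.Relation.Binary.Disjoint.Propositional.Properties as Disjoint
open import Data.List.Relation.Unary.Unique.Propositional using (Unique)
import Data.List.Relation.Unary.Unique.Propositional.Properties as Unique
open import Data.List.Relation.Binary.BagAndSetEquality using (∼bag⇒↭)
open import Data.List.Relation.Binary.Permutation.Propositional using (_↭_; ↭-refl; ↭-sym; ↭-trans; ↭-reflexive; prep; module PermutationReasoning)
import Data.List.Relation.Binary.Permutation.Propositional.Properties as Perm
open import Data.Product using (_×_; _,_; proj₁; proj₂; ∃; ∃₂; map₁)
open import Data.Sum using (_⊎_; inj₁; inj₂)
open import Data.Unit using (⊤; tt)
open import Data.Empty using (⊥; ⊥-elim)
open import Function.Base using (_∘_)
open import Function.Bundles using (mk⇔; Equivalence)
open import Relation.Nullary using (yes; no)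
open import Relation.Nullary.Decidable using (T?)
open import Relation.Binary.PropositionalEquality hiding ([_])

map-unique : {A B : Set} (f : A → B) {ys : List A} →
  (∀ {x y} → x ∈ ys → y ∈ ys → f x ≡ f y → x ≡ y) → Unique ys → Unique (map f ys)
map-unique f inj [] = []
map-unique f inj (y∉ ∷ u) =
  All.map⁺ (All.tabulate (λ z∈ fy≡fz → All.lookup y∉ z∈ (inj (here refl) (there z∈) fy≡fz)))
  ∷ map-unique f (λ x∈ y∈ → inj (there x∈) (there y∈)) u

count-involution : {A : Set} (xs : List A) (f : A → A) (p q : A → Bool) → Unique xs →
  (∀ {x} → x ∈ xs → f x ∈ xs) → (∀ {x} → x ∈ xs → f (f x) ≡ x) →
  (∀ {x} → x ∈ xs → p (f x) ≡ q x) →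
  length (filterᵇ q xs) ≡ length (filterᵇ p xs)
count-involution xs f p q unique closed involutive transfers = begin
  length (filterᵇ q xs)          ≡⟨ sym (length-map f (filterᵇ q xs)) ⟩
  length (map f (filterᵇ q xs))  ≡⟨ Perm.↭-length (∼bag⇒↭ (unique∧set⇒bag image-unique (filter-unique p)
                                                        (mk⇔ image⊆ ⊆image))) ⟩
  length (filterᵇ p xs)          ∎
  where
  open ≡-Reasoning
  filter-unique : ∀ r → Unique (filterᵇ r xs)
  filter-unique r = Unique.filter⁺ (T? ∘ r) unique
  image-unique : Unique (map f (filterᵇ q xs))
  image-unique = map-unique f
    (λ x∈ y∈ fx≡fy → trans (sym (involutive (proj₁ (∈-filter⁻ (T? ∘ q) x∈))))
                       (trans (cong f fx≡fy) (involutive (proj₁ (∈-filter⁻ (T? ∘ q) y∈)))))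
    (filter-unique q)
  image⊆ : ∀ {y} → y ∈ map f (filterᵇ q xs) → y ∈ filterᵇ p xs
  image⊆ y∈ with ∈-map⁻ f y∈
  ... | x , x∈ , refl with ∈-filter⁻ (T? ∘ q) x∈
  ... | x∈xs , qx = ∈-filter⁺ (T? ∘ p) (closed x∈xs) (subst T (sym (transfers x∈xs)) qx)
  ⊆image : ∀ {y} → y ∈ filterᵇ p xs → y ∈ map f (filterᵇ q xs)
  ⊆image {y} y∈ with ∈-filter⁻ (T? ∘ p) y∈
  ... | y∈xs , py = subst (_∈ map f (filterᵇ q xs)) (involutive y∈xs)
    (∈-map⁺ f (∈-filter⁺ (T? ∘ q) (closed y∈xs)
      (subst T (trans (cong p (sym (involutive y∈xs))) (transfers (closed y∈xs))) py)))

alphabet-unique : ∀ m → Unique [ 1 ⋯ m ]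
alphabet-unique m = Unique.applyUpTo⁺₁ suc m (λ i<j _ → <⇒≢ i<j ∘ suc-injective)

words-suc : ∀ k m → words (suc k) m ≡ cartesianProductWith _∷_ [ 1 ⋯ m ] (words k m)
words-suc k m = prepend-all [ 1 ⋯ m ]
  where
  prepend-all : ∀ xs → concatMap (λ x → map (x ∷_) (words k m)) xs
                     ≡ cartesianProductWith _∷_ xs (words k m)
  prepend-all []       = refl
  prepend-all (x ∷ xs) = cong (map (x ∷_) (words k m) ++_) (prepend-all xs)

words-unique : ∀ k m → Unique (words k m)
words-unique zero    m = [] ∷ []
words-unique (suc k) m rewrite words-suc k m =
  Unique.cartesianProductWith⁺ _∷_ ∷-injective (alphabet-unique m) (words-unique k m)

∈-words⁻ : ∀ k m {w} → w ∈ words k m → length w ≡ k × All (_∈ [ 1 ⋯ m ]) w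
∈-words⁻ zero    m (here refl) = refl , []
∈-words⁻ (suc k) m w∈ rewrite words-suc k m
  with _ , _ , x∈ , t∈ , refl ← ∈-cartesianProductWith⁻ _∷_ [ 1 ⋯ m ] (words k m) w∈ =
  let length≡ , letters = ∈-words⁻ k m t∈ in cong suc length≡ , x∈ ∷ letters

∈-words⁺ : ∀ k m {w} → length w ≡ k → All (_∈ [ 1 ⋯ m ]) w → w ∈ words k m
∈-words⁺ zero    m {[]}    refl []          = here refl
∈-words⁺ (suc k) m {x ∷ t} length≡ (x∈ ∷ letters) rewrite words-suc k m =
  ∈-cartesianProductWith⁺ _∷_ x∈ (∈-words⁺ k m (suc-injective length≡) letters)

ones : Bool → ℕ
ones true  = 1
ones false = 0

#-∷ : ∀ (g : ℕ → Bool) x xs → # g ∈ (x ∷ xs) ≡ ones (g x) + # g ∈ xs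
#-∷ g x xs with g x
... | true  = refl
... | false = refl

#-applyUpTo : ∀ k (F G : ℕ → ℕ) (g h : ℕ → Bool) → (∀ i → g (F i) ≡ h (G i)) →
  # g ∈ applyUpTo F k ≡ # h ∈ applyUpTo G k
#-applyUpTo zero    F G g h agree = refl
#-applyUpTo (suc k) F G g h agree = begin
  # g ∈ applyUpTo F (suc k)                       ≡⟨ #-∷ g (F 0) _ ⟩
  ones (g (F 0)) + # g ∈ applyUpTo (F ∘ suc) k    ≡⟨ cong₂ (λ b n → ones b + n) (agree 0)
                                                       (#-applyUpTo k (F ∘ suc) (G ∘ suc) g h (agree ∘ suc)) ⟩
  ones (h (G 0)) + # h ∈ applyUpTo (G ∘ suc) k    ≡⟨ sym (#-∷ h (G 0) _) ⟩
  # h ∈ applyUpTo G (suc k)                       ∎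
  where open ≡-Reasoning

-- A window predicate looks at a letter together with its two neighbours.
Window : Set
Window = ℕ → ℕ → ℕ → Bool

windows : Window → ℕ → List ℕ → ℕ
windows f p []          = 0
windows f p (x ∷ [])    = 0
windows f p (x ∷ y ∷ r) = ones (f p x y) + windows f x (y ∷ r)

letterAt : ℕ → List ℕ → ℕ → ℕ
letterAt p w zero    = p
letterAt p w (suc i) = nth w i

windowAt : Window → ℕ → List ℕ → ℕ → Bool
windowAt f p w i = f (letterAt p w (i ∸ 1)) (letterAt p w i) (letterAt p w (suc i))

windows-as-count : ∀ f p w → # windowAt f p w ∈ applyUpTo suc (length w ∸ 1) ≡ windows f p w
windows-as-count f p []          = refl
windows-as-count f p (x ∷ [])    = refl
windows-as-count f p (x ∷ y ∷ r) =
  trans (#-∷ (windowAt f p (x ∷ y ∷ r)) 1 _)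
        (cong (ones (f p x y) +_)
              (trans (#-applyUpTo (length r) (suc ∘ suc) suc _ _ shift)
                     (windows-as-count f x (y ∷ r))))
  where
  previous : ∀ j → letterAt p (x ∷ y ∷ r) (suc j) ≡ letterAt x (y ∷ r) j
  previous zero    = refl
  previous (suc j) = refl
  shift : ∀ i → windowAt f p (x ∷ y ∷ r) (suc (suc i)) ≡ windowAt f x (y ∷ r) (suc i)
  shift i = cong (λ l → f l (nth (y ∷ r) i) (nth (y ∷ r) (suc i))) (previous i)

statistic-windows : ∀ f w →
  # (λ i → f (σ w (i ∸ 1)) (σ w i) (σ w (suc i))) ∈ [ 1 ⋯ length w ∸ 1 ] ≡ windows f 0 w
statistic-windows f w =
  trans (#-applyUpTo (length w ∸ 1) suc suc _ (windowAt f 0 w)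
          (λ i → cong (λ l → f l (nth w i) (nth w (suc i))) (σ≗letterAt i)))
        (windows-as-count f 0 w)
  where
  σ≗letterAt : ∀ j → σ w j ≡ letterAt 0 w j
  σ≗letterAt zero    = refl
  σ≗letterAt (suc j) = refl

lapᶠ dascᶠ dpᶠ platᶠ ascᶠ : Window
lapᶠ  p x y = (p <ᵇ x) ∧ (x ≡ᵇ y)
dascᶠ p x y = (p <ᵇ x) ∧ (x <ᵇ y)
dpᶠ   p x y = (x <ᵇ p) ∧ (x ≡ᵇ y)
platᶠ p x y = x ≡ᵇ y
ascᶠ  p x y = x <ᵇ y

lap-windows : ∀ w → lap w ≡ windows lapᶠ 0 w
lap-windows = statistic-windows lapᶠ

dasc-windows : ∀ w → dasc w ≡ windows dascᶠ 0 w
dasc-windows = statistic-windows dascᶠ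

dp-windows : ∀ w → dp w ≡ windows dpᶠ 0 w
dp-windows = statistic-windows dpᶠ

plat-windows : ∀ w → plat w ≡ windows platᶠ 0 w
plat-windows = statistic-windows platᶠ

asc-windows : ∀ w → w ≢ [] → asc w ≡ 1 + windows ascᶠ 0 w
asc-windows []      w≢[] = ⊥-elim (w≢[] refl)
asc-windows (x ∷ r) _    =
  cong suc (trans (#-applyUpTo (length r) (suc ∘ suc) suc _ (windowAt ascᶠ 0 (x ∷ r)) (λ i → refl))
                  (windows-as-count ascᶠ 0 (x ∷ r)))

<ᵇ-true : ∀ {m n} → m < n → (m <ᵇ n) ≡ true
<ᵇ-true {zero}  {suc n} _         = refl
<ᵇ-true {suc m} {suc n} (s≤s m<n) = <ᵇ-true m<n

<ᵇ-false : ∀ {m n} → n ≤ m → (m <ᵇ n) ≡ false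
<ᵇ-false {m}     {zero}  _         = refl
<ᵇ-false {suc m} {suc n} (s≤s n≤m) = <ᵇ-false n≤m

≡ᵇ-refl : ∀ m → (m ≡ᵇ m) ≡ true
≡ᵇ-refl zero    = refl
≡ᵇ-refl (suc m) = ≡ᵇ-refl m

≡ᵇ-false : ∀ {m n} → m ≢ n → (m ≡ᵇ n) ≡ false
≡ᵇ-false {zero}  {zero}  m≢n = ⊥-elim (m≢n refl)
≡ᵇ-false {zero}  {suc n} _   = refl
≡ᵇ-false {suc m} {zero}  _   = refl
≡ᵇ-false {suc m} {suc n} m≢n = ≡ᵇ-false (m≢n ∘ cong suc)

cong₃ : ∀ {A B C D : Set} (g : A → B → C → D) {x x′ y y′ z z′} →
  x ≡ x′ → y ≡ y′ → z ≡ z′ → g x y z ≡ g x′ y′ z′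
cong₃ g refl refl refl = refl

data Tree : Set where
  leaf : Tree
  node : ℕ → Tree → Tree → Tree → Tree

word : Tree → List ℕ
word leaf           = []
word (node m a b c) = word a ++ m ∷ word b ++ m ∷ word c

isLeaf : Tree → Bool
isLeaf leaf           = true
isLeaf (node _ _ _ _) = false

Increasing : ℕ → Tree → Set
Increasing lo leaf           = ⊤
Increasing lo (node m a b c) = lo < m × Increasing m a × Increasing m b × Increasing m c

Increasing-weaken : ∀ {l l′} T → l ≤ l′ → Increasing l′ T → Increasing l T
Increasing-weaken leaf           _    _             = tt
Increasing-weaken (node m a b c) l≤l′ (l′<m , rest) = ≤-<-trans l≤l′ l′<m , rest

letters-above : ∀ {lo} T → Increasing lo T → All (lo <_) (word T)
letters-above leaf _ = []
letters-above {lo} (node m a b c) (lo<m , inc-a , inc-b , inc-c) =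
  All.++⁺ (raise (letters-above a inc-a))
          (lo<m ∷ All.++⁺ (raise (letters-above b inc-b)) (lo<m ∷ raise (letters-above c inc-c)))
  where
  raise : ∀ {w} → All (m <_) w → All (lo <_) w
  raise = All.map (<-trans lo<m)

word-nonempty : ∀ T → isLeaf T ≡ false → word T ≢ []
word-nonempty (node m a b c) _ with word a
... | []    = λ ()
... | _ ∷ _ = λ ()

headOr : ℕ → List ℕ → ℕ
headOr m []      = m
headOr m (x ∷ _) = x

lastOr : ℕ → List ℕ → ℕ
lastOr p []      = p
lastOr p (x ∷ w) = lastOr x w

headOr-∈ : ∀ m w → w ≢ [] → headOr m w ∈ w
headOr-∈ m []      w≢[] = ⊥-elim (w≢[] refl)
headOr-∈ m (x ∷ w) _    = here refl

lastOr-∈ : ∀ p w → w ≢ [] → lastOr p w ∈ w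
lastOr-∈ p []          w≢[] = ⊥-elim (w≢[] refl)
lastOr-∈ p (x ∷ [])    _    = here refl
lastOr-∈ p (x ∷ y ∷ w) _    = there (lastOr-∈ x (y ∷ w) (λ ()))

IgnoresFalls : Window → Set
IgnoresFalls f = ∀ p x y → y < x → f p x y ≡ false

-- Appending after a block w all of whose letters exceed the next letter y
-- splits the window count: the last letter of w is followed by a fall.
windows-++ : ∀ f → IgnoresFalls f → ∀ p w y R → All (y <_) w →
  windows f p (w ++ y ∷ R) ≡ windows f p w + windows f (lastOr p w) (y ∷ R)
windows-++ f falls p []           y R _            = refl
windows-++ f falls p (x ∷ [])     y R (y<x ∷ [])   = cong (λ b → ones b + windows f x (y ∷ R)) (falls p x y y<x)
windows-++ f falls p (x ∷ x′ ∷ w) y R (_ ∷ above) =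
  trans (cong (ones (f p x x′) +_) (windows-++ f falls x (x′ ∷ w) y R above))
        (sym (+-assoc (ones (f p x x′)) (windows f x (x′ ∷ w)) _))

windows-∷ : ∀ f r m v → v ≢ [] → windows f r (m ∷ v) ≡ ones (f r m (headOr m v)) + windows f m v
windows-∷ f r m []      v≢[] = ⊥-elim (v≢[] refl)
windows-∷ f r m (x ∷ v) _    = refl

windows-split : ∀ f → IgnoresFalls f → ∀ p m wa wb wc → All (m <_) wa → All (m <_) wb →
  windows f p (wa ++ m ∷ wb ++ m ∷ wc)
    ≡ windows f p wa + (ones (f (lastOr p wa) m (headOr m wb))
                        + (windows f m wb + windows f (lastOr m wb) (m ∷ wc)))
windows-split f falls p m wa wb wc above-a above-b =
  trans (windows-++ f falls p wa m _ above-a) (cong (windows f p wa +_) (middle wb above-b))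
  where
  middle : ∀ wb → All (m <_) wb →
    windows f (lastOr p wa) (m ∷ wb ++ m ∷ wc)
      ≡ ones (f (lastOr p wa) m (headOr m wb)) + (windows f m wb + windows f (lastOr m wb) (m ∷ wc))
  middle []        _       = refl
  middle (x ∷ wb′) above-b′ = cong (ones (f (lastOr p wa) m x) +_) (windows-++ f falls m (x ∷ wb′) m wc above-b′)

-- A window predicate is determined by the shape of a tree when, at the two
-- occurrences of a node label m, its value only depends on which neighbouring
-- subtrees are empty.  At the first occurrence m is preceded either by a smaller
-- letter (empty left subtree) or by a larger one, and followed either by m itself
-- (empty middle subtree) or by a larger letter: the value is  first a b,  a and b
-- telling whether the left and middle subtrees are empty.  At the second occurrence
-- the preceding letter is ≥ m; if the right subtree is nonempty the value is
-- second, and otherwise the position is followed by a fall or ends the word.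
record ShapeDetermined (f : Window) (first : Bool → Bool → Bool) (second : Bool) : Set where
  field
    falls        : IgnoresFalls f
    rise-plateau : ∀ p m → p < m → f p m m ≡ first true true
    rise-rise    : ∀ p m y → p < m → m < y → f p m y ≡ first true false
    fall-plateau : ∀ q m → m < q → f q m m ≡ first false true
    fall-rise    : ∀ q m y → m < q → m < y → f q m y ≡ first false false
    after-second : ∀ r m y → m ≤ r → m < y → f r m y ≡ second

nodeSum : (Bool → Bool → Bool → ℕ) → Tree → ℕ
nodeSum κ leaf           = 0
nodeSum κ (node m a b c) = κ (isLeaf a) (isLeaf b) (isLeaf c) + (nodeSum κ a + nodeSum κ b + nodeSum κ c)

shapeWeight : (Bool → Bool → Bool) → Bool → Bool → Bool → Bool → ℕ
shapeWeight first second a b c = ones (first a b) + ones (not c ∧ second)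

lastOr-≥ : ∀ m w → All (m <_) w → m ≤ lastOr m w
lastOr-≥ m []      _     = ≤-refl
lastOr-≥ m (x ∷ w) above = <⇒≤ (All.lookup above (lastOr-∈ m (x ∷ w) (λ ())))

module _ {f first second} (S : ShapeDetermined f first second) where
  open ShapeDetermined S

  at-first : ∀ p m a b → p < m → All (m <_) (word a) → All (m <_) (word b) →
    f (lastOr p (word a)) m (headOr m (word b)) ≡ first (isLeaf a) (isLeaf b)
  at-first p m leaf leaf p<m _ _ = rise-plateau p m p<m
  at-first p m leaf b@(node _ _ _ _) p<m _ above-b =
    rise-rise p m _ p<m (All.lookup above-b (headOr-∈ m (word b) (word-nonempty b refl)))
  at-first p m a@(node _ _ _ _) leaf p<m above-a _ =
    fall-plateau _ m (All.lookup above-a (lastOr-∈ p (word a) (word-nonempty a refl)))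
  at-first p m a@(node _ _ _ _) b@(node _ _ _ _) p<m above-a above-b =
    fall-rise _ m _ (All.lookup above-a (lastOr-∈ p (word a) (word-nonempty a refl)))
                    (All.lookup above-b (headOr-∈ m (word b) (word-nonempty b refl)))

  from-second : ∀ r m c → m ≤ r → Increasing m c →
    windows f r (m ∷ word c) ≡ ones (not (isLeaf c) ∧ second) + windows f m (word c)
  from-second r m leaf               _   _     = refl
  from-second r m c@(node _ _ _ _) m≤r inc-c =
    trans (windows-∷ f r m (word c) (word-nonempty c refl))
          (cong (λ b → ones b + windows f m (word c))
                (after-second r m _ m≤r (All.lookup (letters-above c inc-c)
                                                    (headOr-∈ m (word c) (word-nonempty c refl)))))

  windows-tree : ∀ p T → Increasing p T → windows f p (word T) ≡ nodeSum (shapeWeight first second) T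
  windows-tree p leaf           _ = refl
  windows-tree p (node m a b c) (p<m , inc-a , inc-b , inc-c) = begin
    windows f p (word (node m a b c))
      ≡⟨ windows-split f falls p m (word a) (word b) (word c) above-a above-b ⟩
    windows f p (word a) + (ones (f (lastOr p (word a)) m (headOr m (word b)))
                           + (windows f m (word b) + windows f (lastOr m (word b)) (m ∷ word c)))
      ≡⟨ cong₂ _+_ (windows-tree p a (Increasing-weaken a (<⇒≤ p<m) inc-a))
           (cong₂ _+_ (cong ones (at-first p m a b p<m above-a above-b))
             (cong₂ _+_ (windows-tree m b inc-b)
               (trans (from-second _ m c (lastOr-≥ m (word b) above-b) inc-c)
                      (cong (ones (not (isLeaf c) ∧ second) +_) (windows-tree m c inc-c))))) ⟩
    A + (ones (first (isLeaf a) (isLeaf b)) + (B + (ones (not (isLeaf c) ∧ second) + C)))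
      ≡⟨ regroup A (ones (first (isLeaf a) (isLeaf b))) B (ones (not (isLeaf c) ∧ second)) C ⟩
    nodeSum (shapeWeight first second) (node m a b c) ∎
    where
    open ≡-Reasoning
    above-a = letters-above a inc-a
    above-b = letters-above b inc-b
    A = nodeSum (shapeWeight first second) a
    B = nodeSum (shapeWeight first second) b
    C = nodeSum (shapeWeight first second) c
    regroup : ∀ A g B h C → A + (g + (B + (h + C))) ≡ (g + h) + (A + B + C)
    regroup = solve-∀

lap-shape : ShapeDetermined lapᶠ (λ a b → a ∧ b) false
lap-shape = record
  { falls        = λ p x y y<x → trans (cong ((p <ᵇ x) ∧_) (≡ᵇ-false (<⇒≢ y<x ∘ sym))) (∧-zeroʳ _)
  ; rise-plateau = λ p m p<m → cong₂ _∧_ (<ᵇ-true p<m) (≡ᵇ-refl m)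
  ; rise-rise    = λ p m y p<m m<y → cong₂ _∧_ (<ᵇ-true p<m) (≡ᵇ-false (<⇒≢ m<y))
  ; fall-plateau = λ q m m<q → cong (_∧ (m ≡ᵇ m)) (<ᵇ-false (<⇒≤ m<q))
  ; fall-rise    = λ q m y m<q m<y → cong (_∧ (m ≡ᵇ y)) (<ᵇ-false (<⇒≤ m<q))
  ; after-second = λ r m y m≤r m<y → cong (_∧ (m ≡ᵇ y)) (<ᵇ-false m≤r)
  }

dasc-shape : ShapeDetermined dascᶠ (λ a b → a ∧ not b) false
dasc-shape = record
  { falls        = λ p x y y<x → trans (cong ((p <ᵇ x) ∧_) (<ᵇ-false (<⇒≤ y<x))) (∧-zeroʳ _)
  ; rise-plateau = λ p m p<m → cong₂ _∧_ (<ᵇ-true p<m) (<ᵇ-false (≤-refl {m}))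
  ; rise-rise    = λ p m y p<m m<y → cong₂ _∧_ (<ᵇ-true p<m) (<ᵇ-true m<y)
  ; fall-plateau = λ q m m<q → cong (_∧ (m <ᵇ m)) (<ᵇ-false (<⇒≤ m<q))
  ; fall-rise    = λ q m y m<q m<y → cong (_∧ (m <ᵇ y)) (<ᵇ-false (<⇒≤ m<q))
  ; after-second = λ r m y m≤r m<y → cong (_∧ (m <ᵇ y)) (<ᵇ-false m≤r)
  }

dp-shape : ShapeDetermined dpᶠ (λ a b → not a ∧ b) false
dp-shape = record
  { falls        = λ p x y y<x → trans (cong ((x <ᵇ p) ∧_) (≡ᵇ-false (<⇒≢ y<x ∘ sym))) (∧-zeroʳ _)
  ; rise-plateau = λ p m p<m → cong (_∧ (m ≡ᵇ m)) (<ᵇ-false (<⇒≤ p<m))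
  ; rise-rise    = λ p m y p<m m<y → cong (_∧ (m ≡ᵇ y)) (<ᵇ-false (<⇒≤ p<m))
  ; fall-plateau = λ q m m<q → cong₂ _∧_ (<ᵇ-true m<q) (≡ᵇ-refl m)
  ; fall-rise    = λ q m y m<q m<y → trans (cong ((m <ᵇ q) ∧_) (≡ᵇ-false (<⇒≢ m<y))) (∧-zeroʳ _)
  ; after-second = λ r m y m≤r m<y → trans (cong ((m <ᵇ r) ∧_) (≡ᵇ-false (<⇒≢ m<y))) (∧-zeroʳ _)
  }

plat-shape : ShapeDetermined platᶠ (λ a b → b) false
plat-shape = record
  { falls        = λ p x y y<x → ≡ᵇ-false (<⇒≢ y<x ∘ sym)
  ; rise-plateau = λ p m p<m → ≡ᵇ-refl m
  ; rise-rise    = λ p m y p<m m<y → ≡ᵇ-false (<⇒≢ m<y)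
  ; fall-plateau = λ q m m<q → ≡ᵇ-refl m
  ; fall-rise    = λ q m y m<q m<y → ≡ᵇ-false (<⇒≢ m<y)
  ; after-second = λ r m y m≤r m<y → ≡ᵇ-false (<⇒≢ m<y)
  }

asc-shape : ShapeDetermined ascᶠ (λ a b → not b) true
asc-shape = record
  { falls        = λ p x y y<x → <ᵇ-false (<⇒≤ y<x)
  ; rise-plateau = λ p m p<m → <ᵇ-false (≤-refl {m})
  ; rise-rise    = λ p m y p<m m<y → <ᵇ-true m<y
  ; fall-plateau = λ q m m<q → <ᵇ-false (≤-refl {m})
  ; fall-rise    = λ q m y m<q m<y → <ᵇ-true m<y
  ; after-second = λ r m y m≤r m<y → <ᵇ-true m<y
  }

swap : Tree → Tree
swap leaf           = leaf
swap (node m a b c) = node m (swap b) (swap a) (swap c)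

swap-involutive : ∀ T → swap (swap T) ≡ T
swap-involutive leaf           = refl
swap-involutive (node m a b c) = cong₃ (node m) (swap-involutive a) (swap-involutive b) (swap-involutive c)

isLeaf-swap : ∀ T → isLeaf (swap T) ≡ isLeaf T
isLeaf-swap leaf           = refl
isLeaf-swap (node _ _ _ _) = refl

word-swap : ∀ T → word (swap T) ↭ word T
word-swap leaf           = ↭-refl
word-swap (node m a b c) = begin
  word (swap b) ++ m ∷ word (swap a) ++ m ∷ word (swap c) ↭⟨ Perm.++⁺ (word-swap b) (prep m (Perm.++⁺ (word-swap a) (prep m (word-swap c)))) ⟩
  word b ++ m ∷ word a ++ m ∷ word c                      ≡⟨ regroup (word b) (word a) ⟩
  (word b ++ [ m ]) ++ (word a ++ [ m ]) ++ word c        ↭⟨ Perm.shifts (word b ++ [ m ]) (word a ++ [ m ]) ⟩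
  (word a ++ [ m ]) ++ (word b ++ [ m ]) ++ word c        ≡⟨ sym (regroup (word a) (word b)) ⟩
  word a ++ m ∷ word b ++ m ∷ word c                      ∎
  where
  open PermutationReasoning
  regroup : ∀ xs ys → xs ++ m ∷ ys ++ m ∷ word c ≡ (xs ++ [ m ]) ++ (ys ++ [ m ]) ++ word c
  regroup xs ys = trans (cong (xs ++_) (cong (m ∷_) (sym (++-assoc ys [ m ] (word c)))))
                        (sym (++-assoc xs [ m ] _))

nodeSum-swap : ∀ κ T → nodeSum κ (swap T) ≡ nodeSum (λ a b c → κ b a c) T
nodeSum-swap κ leaf = refl
nodeSum-swap κ (node m a b c)
  rewrite isLeaf-swap a | isLeaf-swap b | isLeaf-swap c
        | nodeSum-swap κ a | nodeSum-swap κ b | nodeSum-swap κ c =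
  cong (κ (isLeaf b) (isLeaf a) (isLeaf c) +_) (cong (_+ nodeSum κ′ c) (+-comm (nodeSum κ′ b) (nodeSum κ′ a)))
  where
  κ′ = λ a b c → κ b a c

nodeSum-cong : ∀ {κ λ′} → (∀ a b c → κ a b c ≡ λ′ a b c) → ∀ T → nodeSum κ T ≡ nodeSum λ′ T
nodeSum-cong same leaf           = refl
nodeSum-cong same (node m a b c) =
  cong₂ _+_ (same _ _ _) (cong₂ _+_ (cong₂ _+_ (nodeSum-cong same a) (nodeSum-cong same b)) (nodeSum-cong same c))

ones-not : ∀ b → ones b + ones (not b) ≡ 1
ones-not true  = refl
ones-not false = refl

-- Once transported back through the swap, the rises of a tree word are counted by
-- the nonempty left and right children; together with the first position they are
-- as many as the nodes with an empty middle child (the plateaus), since every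
-- non-root node is a nonempty child of exactly one node.
rises-vs-plateaus : ∀ T →
  ones (not (isLeaf T)) + nodeSum (λ a b c → shapeWeight (λ a b → not b) true b a c) T
    ≡ nodeSum (shapeWeight (λ a b → b) false) T
rises-vs-plateaus leaf           = refl
rises-vs-plateaus (node m a b c) = sym (begin
  (ones lb + ones (not lc ∧ false)) + (P a + P b + P c)
    ≡⟨ cong₂ (λ x y → (ones lb + ones x) + y) (∧-zeroʳ (not lc))
         (sym (cong₂ _+_ (cong₂ _+_ (rises-vs-plateaus a) (rises-vs-plateaus b)) (rises-vs-plateaus c))) ⟩
  (ones lb + 0) + ((ones (not la) + R a) + (ones (not lb) + R b) + (ones (not lc) + R c))
    ≡⟨ regroup (ones lb) (ones (not la)) (ones (not lb)) (ones (not lc)) (R a) (R b) (R c) ⟩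
  (ones lb + ones (not lb)) + ((ones (not la) + ones (not lc)) + (R a + R b + R c))
    ≡⟨ cong₂ (λ x y → x + ((ones (not la) + ones y) + (R a + R b + R c))) (ones-not lb) (sym (∧-identityʳ (not lc))) ⟩
  1 + ((ones (not la) + ones (not lc ∧ true)) + (R a + R b + R c)) ∎)
  where
  open ≡-Reasoning
  la = isLeaf a
  lb = isLeaf b
  lc = isLeaf c
  R = nodeSum (λ a b c → shapeWeight (λ a b → not b) true b a c)
  P = nodeSum (shapeWeight (λ a b → b) false)
  regroup : ∀ x na nb nc ra rb rc →
    (x + 0) + ((na + ra) + (nb + rb) + (nc + rc)) ≡ (x + nb) + ((na + nc) + (ra + rb + rc))
  regroup = solve-∀

Stirling : List ℕ → Set
Stirling w = ∀ xs ys zs a → w ≡ xs ++ a ∷ ys ++ a ∷ zs → All (a <_) ys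

++-split : ∀ (A R xs : List ℕ) a M → A ++ R ≡ xs ++ a ∷ M →
  (∃ λ A₂ → A ≡ xs ++ a ∷ A₂ × M ≡ A₂ ++ R) ⊎ (∃ λ R₁ → xs ≡ A ++ R₁ × R ≡ R₁ ++ a ∷ M)
++-split []      R xs       a M eq   = inj₂ (xs , refl , eq)
++-split (x ∷ A) R []       a M eq with refl , refl ← ∷-injective eq = inj₁ (A , refl , refl)
++-split (x ∷ A) R (y ∷ xs) a M eq with refl , eq′ ← ∷-injective eq with ++-split A R xs a M eq′
... | inj₁ (A₂ , A≡ , M≡) = inj₁ (A₂ , cong (x ∷_) A≡ , M≡)
... | inj₂ (R₁ , xs≡ , R≡) = inj₂ (R₁ , cong (x ∷_) xs≡ , R≡)

Stirling-++ : ∀ A R → Stirling A → Stirling R → Disjoint A R → Stirling (A ++ R)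
Stirling-++ A R stir-A stir-R disjoint xs ys zs a eq with ++-split A R xs a (ys ++ a ∷ zs) eq
... | inj₂ (R₁ , _ , R≡) = stir-R R₁ ys zs a R≡
... | inj₁ (A₂ , A≡ , M≡) with ++-split A₂ R ys a zs (sym M≡)
...   | inj₁ (A₃ , A₂≡ , _) = stir-A xs ys A₃ a (trans A≡ (cong (λ t → xs ++ a ∷ t) A₂≡))
...   | inj₂ (R₁ , _ , R≡)  = ⊥-elim (disjoint (subst (a ∈_) (sym A≡) (∈-insert xs) ,
                                                  subst (a ∈_) (sym R≡) (∈-insert R₁)))

Guarded : ℕ → List ℕ → Set
Guarded m X = ∀ ys zs → X ≡ ys ++ m ∷ zs → All (m <_) ys

Stirling-∷ : ∀ m X → Guarded m X → Stirling X → Stirling (m ∷ X)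
Stirling-∷ m X guarded stir-X []       ys zs a refl = guarded ys zs refl
Stirling-∷ m X guarded stir-X (x ∷ xs) ys zs a refl = stir-X xs ys zs a refl

Guarded-∉ : ∀ m X → m ∉ X → Guarded m X
Guarded-∉ m X m∉X ys zs refl = ⊥-elim (m∉X (∈-insert ys))

Guarded-middle : ∀ m B C → m ∉ B → m ∉ C → All (m <_) B → Guarded m (B ++ m ∷ C)
Guarded-middle m B C m∉B m∉C above-B ys zs eq with ++-split B (m ∷ C) ys m zs eq
... | inj₁ (A₂ , B≡ , _)        = ⊥-elim (m∉B (subst (m ∈_) (sym B≡) (∈-insert ys)))
... | inj₂ ([] , ys≡ , _)       = subst (All (m <_)) (trans (sym (++-identityʳ B)) (sym ys≡)) above-B
... | inj₂ (x ∷ R₁ , _ , mC≡) with refl , C≡ ← ∷-injective mC≡ = ⊥-elim (m∉C (subst (m ∈_) (sym C≡) (∈-insert R₁)))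

Stirling-suffix : ∀ xs w → Stirling (xs ++ w) → Stirling w
Stirling-suffix xs w stir P Q R a refl = stir (xs ++ P) Q R a (sym (++-assoc xs P _))

Stirling-prefix : ∀ w ys → Stirling (w ++ ys) → Stirling w
Stirling-prefix w ys stir P Q R a refl =
  stir P Q (R ++ ys) a (trans (++-assoc P (a ∷ Q ++ a ∷ R) ys)
                              (cong (λ t → P ++ a ∷ t) (++-assoc Q (a ∷ R) ys)))

separated : ∀ L m R′ x → Stirling (L ++ m ∷ R′) → x ∈ L → x ∈ R′ → x < m
separated L m R′ x stir x∈L x∈R′
  with L₁ , L₂ , refl ← ∈-∃++ x∈L | R₁ , R₂ , refl ← ∈-∃++ x∈R′ =
  All.lookup (stir L₁ (L₂ ++ m ∷ R₁) R₂ x regroup) (∈-insert L₂)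
  where
  regroup : (L₁ ++ x ∷ L₂) ++ m ∷ R₁ ++ x ∷ R₂ ≡ L₁ ++ x ∷ (L₂ ++ m ∷ R₁) ++ x ∷ R₂
  regroup = trans (++-assoc L₁ (x ∷ L₂) _) (cong (λ t → L₁ ++ x ∷ t) (sym (++-assoc L₂ (m ∷ R₁) (x ∷ R₂))))

-- The Stirling condition in index form (positions counted from 0).
StirlingAt : List ℕ → Set
StirlingAt w = ∀ i j k → i < j → j < k → k < length w → nth w i ≡ nth w k → nth w i < nth w j

nth-++ʳ : ∀ (xs R : List ℕ) k → nth (xs ++ R) (length xs + k) ≡ nth R k
nth-++ʳ []       R k = refl
nth-++ʳ (x ∷ xs) R k = nth-++ʳ xs R k

nth-++ˡ : ∀ (ys zs : List ℕ) j → j < length ys → nth (ys ++ zs) j ≡ nth ys j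
nth-++ˡ (y ∷ ys) zs zero    _         = refl
nth-++ˡ (y ∷ ys) zs (suc j) (s≤s j<n) = nth-++ˡ ys zs j j<n

nth-at : ∀ (ys : List ℕ) a zs → nth (ys ++ a ∷ zs) (length ys) ≡ a
nth-at []       a zs = refl
nth-at (y ∷ ys) a zs = nth-at ys a zs

nth-∈ : ∀ (ys : List ℕ) j → j < length ys → nth ys j ∈ ys
nth-∈ (y ∷ ys) zero    _         = here refl
nth-∈ (y ∷ ys) (suc j) (s≤s j<n) = there (nth-∈ ys j j<n)

∈⇒nth : ∀ {y} (ys : List ℕ) → y ∈ ys → ∃ λ j → j < length ys × nth ys j ≡ y
∈⇒nth (y ∷ ys) (here refl) = zero , s≤s z≤n , refl
∈⇒nth (_ ∷ ys) (there y∈)  with j , j< , eq ← ∈⇒nth ys y∈ = suc j , s≤s j< , eq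

split-at : ∀ (w : List ℕ) i → i < length w → ∃₂ λ ys zs → w ≡ ys ++ nth w i ∷ zs × length ys ≡ i
split-at (x ∷ w) zero    _         = [] , w , refl , refl
split-at (x ∷ w) (suc i) (s≤s i<n) with ys , zs , eq , len ← split-at w i i<n =
  x ∷ ys , zs , cong (x ∷_) eq , cong suc len

Stirling⇒StirlingAt : ∀ w → Stirling w → StirlingAt w
Stirling⇒StirlingAt (x ∷ w) stir zero (suc j) (suc k) _ (s≤s j<k) (s≤s k<n) x≡
  with ys , zs , w≡ , refl ← split-at w k k<n =
  All.lookup (stir [] ys zs x (cong (x ∷_) (trans w≡ (cong (λ t → ys ++ t ∷ zs) (sym x≡)))))
             (subst (_∈ ys) (sym (trans (cong (λ t → nth t j) w≡) (nth-++ˡ ys _ j j<k))) (nth-∈ ys j j<k))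
Stirling⇒StirlingAt (x ∷ w) stir (suc i) (suc j) (suc k) (s≤s i<j) (s≤s j<k) (s≤s k<n) eq =
  Stirling⇒StirlingAt w (Stirling-suffix (x ∷ []) w stir) i j k i<j j<k k<n eq

StirlingAt⇒Stirling : ∀ w → StirlingAt w → Stirling w
StirlingAt⇒Stirling w stir-at xs ys zs a refl = All.tabulate above
  where
  n = length xs
  first-a : nth (xs ++ a ∷ ys ++ a ∷ zs) n ≡ a
  first-a = nth-at xs a _
  second-a : nth (xs ++ a ∷ ys ++ a ∷ zs) (n + suc (length ys)) ≡ a
  second-a = trans (nth-++ʳ xs _ (suc (length ys))) (nth-at ys a zs)
  length-w : length (xs ++ a ∷ ys ++ a ∷ zs) ≡ n + suc (length ys + suc (length zs))
  length-w = trans (length-++ xs) (cong (λ l → n + suc l) (length-++ ys))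
  above : ∀ {y} → y ∈ ys → a < y
  above y∈ with j , j< , refl ← ∈⇒nth ys y∈ =
    subst₂ _<_ first-a (trans (nth-++ʳ xs _ (suc j)) (nth-++ˡ ys (a ∷ zs) j j<))
      (stir-at n (n + suc j) (n + suc (length ys))
               (m<m+n n z<s) (+-monoʳ-< n (s≤s j<))
               (subst (n + suc (length ys) <_) (sym length-w) (+-monoʳ-< n (s≤s (m<m+n (length ys) z<s))))
               (trans first-a (sym second-a)))

allᵇ-lookup : ∀ {A : Set} (g : A → Bool) xs → T (allᵇ g xs) → ∀ {x} → x ∈ xs → T (g x)
allᵇ-lookup g (x ∷ xs) all (here refl) with g x
... | true = tt
allᵇ-lookup g (x ∷ xs) all (there x∈) with g x
... | true = allᵇ-lookup g xs all x∈

allᵇ-tabulate : ∀ {A : Set} (g : A → Bool) xs → (∀ {x} → x ∈ xs → T (g x)) → T (allᵇ g xs)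
allᵇ-tabulate g []       _     = tt
allᵇ-tabulate g (x ∷ xs) g-all with g x | g-all (here refl)
... | true | _ = allᵇ-tabulate g xs (g-all ∘ there)

allᵇ-cong : ∀ {A : Set} {g h : A → Bool} → (∀ x → g x ≡ h x) → ∀ xs → allᵇ g xs ≡ allᵇ h xs
allᵇ-cong same []       = refl
allᵇ-cong same (x ∷ xs) = cong₂ _∧_ (same x) (allᵇ-cong same xs)

implies-elim : ∀ b₁ b₂ b₃ b₄ → T (not (b₁ ∧ b₂ ∧ b₃) ∨ b₄) → T b₁ → T b₂ → T b₃ → T b₄
implies-elim true true true b₄ t _ _ _ = t

implies-intro : ∀ b₁ b₂ b₃ b₄ → (T b₁ → T b₂ → T b₃ → T b₄) → T (not (b₁ ∧ b₂ ∧ b₃) ∨ b₄)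
implies-intro true  true  true  b₄ h = h tt tt tt
implies-intro true  true  false b₄ h = tt
implies-intro true  false b₃    b₄ h = tt
implies-intro false b₂    b₃    b₄ h = tt

-- The Boolean condition of the definition is the index form (shifted by one).
stirlingCond⇒StirlingAt : ∀ w → T (stirlingCond w) → StirlingAt w
stirlingCond⇒StirlingAt w cond i j k i<j j<k k<n i≡k =
  <ᵇ⇒< _ _ (implies-elim _ _ _ _ at-i-k-j (<⇒<ᵇ (s≤s i<j)) (<⇒<ᵇ (s≤s j<k)) (≡⇒≡ᵇ _ _ i≡k))
  where
  positions = [ 1 ⋯ length w ]
  position : ∀ {i} → i < length w → suc i ∈ positions
  position = ∈-applyUpTo⁺ suc
  j<n = <-trans j<k k<n
  at-i-k-j = allᵇ-lookup _ positions
               (allᵇ-lookup _ positions (allᵇ-lookup _ positions cond (position (<-trans i<j j<n)))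
                            (position k<n))
               (position j<n)

StirlingAt⇒stirlingCond : ∀ w → StirlingAt w → T (stirlingCond w)
StirlingAt⇒stirlingCond w stir-at =
  allᵇ-tabulate _ positions λ p∈ → allᵇ-tabulate _ positions λ q∈ → allᵇ-tabulate _ positions λ r∈ →
    triple p∈ q∈ r∈
  where
  positions = [ 1 ⋯ length w ]
  triple : ∀ {p q r} → p ∈ positions → q ∈ positions → r ∈ positions →
    T (not ((p <ᵇ r) ∧ (r <ᵇ q) ∧ (σ w p ≡ᵇ σ w q)) ∨ (σ w p <ᵇ σ w r))
  triple p∈ q∈ r∈
    with i , _ , refl ← ∈-applyUpTo⁻ suc p∈
       | k , k<n , refl ← ∈-applyUpTo⁻ suc q∈
       | j , _ , refl ← ∈-applyUpTo⁻ suc r∈ =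
    implies-intro _ _ _ _ λ i<j j<k i≡k →
      <⇒<ᵇ (stir-at i j k (<ᵇ⇒< i j i<j) (<ᵇ⇒< j k j<k) k<n (≡ᵇ⇒≡ _ _ i≡k))

occ-as-filter : ∀ i w → occ i w ≡ length (filterᵇ (i ≡ᵇ_) w)
occ-as-filter i []      = refl
occ-as-filter i (x ∷ w) with i ≡ᵇ x
... | true  = cong suc (occ-as-filter i w)
... | false = occ-as-filter i w

occ-↭ : ∀ i {v w} → v ↭ w → occ i v ≡ occ i w
occ-↭ i {v} {w} v↭w =
  trans (occ-as-filter i v)
        (trans (Perm.↭-length (Perm.filter-↭ (T? ∘ (i ≡ᵇ_)) v↭w)) (sym (occ-as-filter i w)))

occ-++ : ∀ i xs ys → occ i (xs ++ ys) ≡ occ i xs + occ i ys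
occ-++ i []       ys = refl
occ-++ i (x ∷ xs) ys with i ≡ᵇ x
... | true  = cong suc (occ-++ i xs ys)
... | false = occ-++ i xs ys

occ-here : ∀ m R → occ m (m ∷ R) ≡ suc (occ m R)
occ-here m R rewrite ≡ᵇ-refl m = refl

occ-there : ∀ x m R → x ≢ m → occ x (m ∷ R) ≡ occ x R
occ-there x m R x≢m rewrite ≡ᵇ-false x≢m = refl

occ-∉ : ∀ i w → i ∉ w → occ i w ≡ 0
occ-∉ i []      _   = refl
occ-∉ i (x ∷ w) i∉ with i ≡ᵇ x in eq
... | true  = ⊥-elim (i∉ (here (≡ᵇ⇒≡ i x (subst T (sym eq) tt))))
... | false = occ-∉ i w (i∉ ∘ there)

occ-∈ : ∀ i w → i ∈ w → occ i w ≢ 0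
occ-∈ i (x ∷ w) i∈ with i ≡ᵇ x in eq
occ-∈ i (x ∷ w) i∈          | true  = λ ()
occ-∈ i (i ∷ w) (here refl) | false = λ _ → ⊥-elim (subst T eq (≡⇒≡ᵇ i i refl))
occ-∈ i (x ∷ w) (there i∈)  | false = occ-∈ i w i∈

occ-suc⇒∈ : ∀ i w {n} → occ i w ≡ suc n → i ∈ w
occ-suc⇒∈ i (x ∷ w) occ≡ with i ≡ᵇ x in eq
... | true  = here (≡ᵇ⇒≡ i x (subst T (sym eq) tt))
... | false = there (occ-suc⇒∈ i w occ≡)

-- A tree is good above lo if it is increasing above lo and, at every node, the
-- three subtrees have no label in common.  These are the trees of Stirling words.
Good : ℕ → Tree → Set
Good lo leaf           = ⊤
Good lo (node m a b c) = lo < m × Good m a × Good m b × Good m c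
                       × Disjoint (word a) (word b) × Disjoint (word a) (word c) × Disjoint (word b) (word c)

Good⇒Increasing : ∀ lo T → Good lo T → Increasing lo T
Good⇒Increasing lo leaf           _ = tt
Good⇒Increasing lo (node m a b c) (lo<m , good-a , good-b , good-c , _) =
  lo<m , Good⇒Increasing m a good-a , Good⇒Increasing m b good-b , Good⇒Increasing m c good-c

Disjoint-↭ : ∀ {xs ys xs′ ys′ : List ℕ} → Disjoint xs ys → xs′ ↭ xs → ys′ ↭ ys → Disjoint xs′ ys′
Disjoint-↭ disjoint xs′↭xs ys′↭ys (v∈xs′ , v∈ys′) =
  disjoint (Perm.∈-resp-↭ xs′↭xs v∈xs′ , Perm.∈-resp-↭ ys′↭ys v∈ys′)

-- Swapping preserves goodness, since it only permutes the letters of subtrees.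
Good-swap : ∀ lo T → Good lo T → Good lo (swap T)
Good-swap lo leaf           _ = tt
Good-swap lo (node m a b c) (lo<m , good-a , good-b , good-c , a#b , a#c , b#c) =
  lo<m , Good-swap m b good-b , Good-swap m a good-a , Good-swap m c good-c ,
  Disjoint-↭ (Disjoint.sym a#b) (word-swap b) (word-swap a) ,
  Disjoint-↭ b#c (word-swap b) (word-swap c) ,
  Disjoint-↭ a#c (word-swap a) (word-swap c)

label-absent : ∀ m T → Increasing m T → m ∉ word T
label-absent m T inc m∈ = <-irrefl refl (All.lookup (letters-above T inc) m∈)

Stirling-word : ∀ lo T → Good lo T → Stirling (word T)
Stirling-word lo leaf _ xs ys zs a eq = ⊥-elim (nonempty xs (sym eq))
  where
  nonempty : ∀ xs → xs ++ a ∷ ys ++ a ∷ zs ≢ []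
  nonempty []      ()
  nonempty (_ ∷ _) ()
Stirling-word lo (node m a b c) (_ , good-a , good-b , good-c , a#b , a#c , b#c) =
  Stirling-++ (word a) _ (Stirling-word m a good-a)
    (Stirling-∷ m _ (Guarded-middle m (word b) (word c) m∉b m∉c (letters-above b (inc b good-b)))
       (Stirling-++ (word b) (m ∷ word c) (Stirling-word m b good-b)
          (Stirling-∷ m (word c) (Guarded-∉ m (word c) m∉c) (Stirling-word m c good-c)) b#mc))
    a#rest
  where
  inc = Good⇒Increasing m
  m∉a = label-absent m a (inc a good-a)
  m∉b = label-absent m b (inc b good-b)
  m∉c = label-absent m c (inc c good-c)
  b#mc : Disjoint (word b) (m ∷ word c)
  b#mc (v∈b , here refl) = m∉b v∈b
  b#mc (v∈b , there v∈c) = b#c (v∈b , v∈c)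
  a#rest : Disjoint (word a) (m ∷ word b ++ m ∷ word c)
  a#rest (v∈a , here refl) = m∉a v∈a
  a#rest (v∈a , there v∈) with ∈-++⁻ (word b) v∈
  ... | inj₁ v∈b         = a#b (v∈a , v∈b)
  ... | inj₂ (here refl) = m∉a v∈a
  ... | inj₂ (there v∈c) = a#c (v∈a , v∈c)

minimum : List ℕ → ℕ
minimum []       = 0
minimum (x ∷ xs) = min x xs

minimum-∈ : ∀ w → w ≢ [] → minimum w ∈ w
minimum-∈ []       w≢[] = ⊥-elim (w≢[] refl)
minimum-∈ (x ∷ xs) _ with argmin-sel (λ y → y) x xs
... | inj₁ min≡x = here min≡x
... | inj₂ min∈  = there min∈

minimum-≤ : ∀ w → All (minimum w ≤_) w
minimum-≤ []       = []
minimum-≤ (x ∷ xs) = min≤⊤ x xs ∷ min≤xs x xs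

minimum-unique : ∀ {m} w → m ∈ w → All (m ≤_) w → minimum w ≡ m
minimum-unique w@(_ ∷ _) m∈ m≤ =
  ≤-antisym (All.lookup (minimum-≤ w) m∈) (All.lookup m≤ (minimum-∈ w (λ ())))

cut : ℕ → List ℕ → List ℕ × List ℕ
cut m []      = [] , []
cut m (x ∷ w) with x ≟ m
... | yes _ = [] , w
... | no  _ = map₁ (x ∷_) (cut m w)

cut-∈ : ∀ m w → m ∈ w → w ≡ proj₁ (cut m w) ++ m ∷ proj₂ (cut m w) × m ∉ proj₁ (cut m w)
cut-∈ m (x ∷ w) m∈ with x ≟ m
... | yes refl = refl , λ ()
... | no  x≢m with m∈
...   | here refl = ⊥-elim (x≢m refl)
...   | there m∈w with w≡ , m∉ ← cut-∈ m w m∈w =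
  cong (x ∷_) w≡ , λ { (here refl) → x≢m refl ; (there m∈′) → m∉ m∈′ }

cut-first : ∀ m A R → m ∉ A → cut m (A ++ m ∷ R) ≡ (A , R)
cut-first m []      R _   with m ≟ m
... | yes _   = refl
... | no  m≢m = ⊥-elim (m≢m refl)
cut-first m (x ∷ A) R m∉ with x ≟ m
... | yes refl = ⊥-elim (m∉ (here refl))
... | no  _    = cong (map₁ (x ∷_)) (cut-first m A R (m∉ ∘ there))

pieces : List ℕ → List ℕ × List ℕ × List ℕ
pieces w =
  let m = minimum w
      before , after = cut m w
      between , rest = cut m after
  in before , between , rest

-- Reading a tree off a word: the least letter m is the root, and the blocks
-- before, between and after its two occurrences give the subtrees.  The fuel k
-- bounds the length of the word.
parse : ℕ → List ℕ → Tree
parse zero    w         = leaf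
parse (suc k) []        = leaf
parse (suc k) w@(_ ∷ _) = let A , B , C = pieces w in node (minimum w) (parse k A) (parse k B) (parse k C)

parse-[] : ∀ k → parse k [] ≡ leaf
parse-[] zero    = refl
parse-[] (suc k) = refl

parse-∷ : ∀ k w → w ≢ [] →
  parse (suc k) w ≡ node (minimum w) (parse k (proj₁ (pieces w)))
                                     (parse k (proj₁ (proj₂ (pieces w)))) (parse k (proj₂ (proj₂ (pieces w))))
parse-∷ k []      w≢[] = ⊥-elim (w≢[] refl)
parse-∷ k (x ∷ w) _    = refl

pieces-shorter : ∀ (A : List ℕ) m B C {k} → length (A ++ m ∷ B ++ m ∷ C) ≤ suc k →
  length A ≤ k × length B ≤ k × length C ≤ k
pieces-shorter A m B C {k} ≤suc-k =
  ≤-trans (m≤m+n a _) total ,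
  ≤-trans (≤-trans (m≤m+n b (suc c)) (m≤n+m _ a)) total ,
  ≤-trans (≤-trans (n≤1+n c) (≤-trans (m≤n+m (suc c) b) (m≤n+m _ a))) total
  where
  a = length A
  b = length B
  c = length C
  total : a + (b + suc c) ≤ k
  total = ≤-pred (subst (_≤ suc k)
            (trans (trans (length-++ A) (cong (λ l → a + suc l) (length-++ B))) (+-suc a (b + suc c))) ≤suc-k)

pieces-word : ∀ lo m a b c → Increasing lo (node m a b c) →
  minimum (word (node m a b c)) ≡ m × pieces (word (node m a b c)) ≡ (word a , word b , word c)
pieces-word lo m a b c (_ , inc-a , inc-b , inc-c) = root , blocks
  where
  at-least : ∀ T → Increasing m T → All (m ≤_) (word T)
  at-least T inc = All.map <⇒≤ (letters-above T inc)
  root : minimum (word (node m a b c)) ≡ m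
  root = minimum-unique (word (node m a b c)) (∈-insert (word a))
           (All.++⁺ (at-least a inc-a) (≤-refl ∷ All.++⁺ (at-least b inc-b) (≤-refl ∷ at-least c inc-c)))
  blocks : pieces (word (node m a b c)) ≡ (word a , word b , word c)
  blocks rewrite root
               | cut-first m (word a) (word b ++ m ∷ word c) (label-absent m a inc-a)
               | cut-first m (word b) (word c) (label-absent m b inc-b) = refl

parse-word : ∀ lo T k → Increasing lo T → length (word T) ≤ k → parse k (word T) ≡ T
parse-word lo leaf           k       _   _ = parse-[] k
parse-word lo (node m a b c) zero    _   ≤0 = ⊥-elim (word-nonempty (node m a b c) refl (length≤0 ≤0))
  where
  length≤0 : ∀ {w : List ℕ} → length w ≤ 0 → w ≡ []
  length≤0 {[]} _ = refl
parse-word lo (node m a b c) (suc k) inc@(_ , inc-a , inc-b , inc-c) ≤k = begin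
  parse (suc k) W
    ≡⟨ parse-∷ k W (word-nonempty (node m a b c) refl) ⟩
  node (minimum W) (parse k (proj₁ (pieces W))) (parse k (proj₁ (proj₂ (pieces W)))) (parse k (proj₂ (proj₂ (pieces W))))
    ≡⟨ cong₂ (λ r p → node r (parse k (proj₁ p)) (parse k (proj₁ (proj₂ p))) (parse k (proj₂ (proj₂ p)))) root blocks ⟩
  node m (parse k (word a)) (parse k (word b)) (parse k (word c))
    ≡⟨ cong₃ (node m) (parse-word m a k inc-a a≤) (parse-word m b k inc-b b≤) (parse-word m c k inc-c c≤) ⟩
  node m a b c ∎
  where
  open ≡-Reasoning
  W = word (node m a b c)
  root = proj₁ (pieces-word lo m a b c inc)
  blocks = proj₂ (pieces-word lo m a b c inc)
  shorter = pieces-shorter (word a) m (word b) (word c) ≤k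
  a≤ = proj₁ shorter
  b≤ = proj₁ (proj₂ shorter)
  c≤ = proj₂ (proj₂ shorter)

-- The invariant of parsing: a Stirling word above lo in which every letter occurs twice.
record Admissible (lo : ℕ) (w : List ℕ) : Set where
  field
    stirling : Stirling w
    twice    : ∀ {x} → x ∈ w → occ x w ≡ 2
    above    : All (lo <_) w

occ-after-first : ∀ m A R → m ∉ A → occ m (A ++ m ∷ R) ≡ suc (occ m R)
occ-after-first m A R m∉A = trans (occ-++ m A (m ∷ R)) (cong₂ _+_ (occ-∉ m A m∉A) (occ-here m R))

split-at-minimum : ∀ {lo} w → Admissible lo w → w ≢ [] →
  let m = minimum w ; A , B , C = pieces w
  in w ≡ A ++ m ∷ B ++ m ∷ C × m ∉ A × m ∉ B × m ∉ C
split-at-minimum w adm w≢[] =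
  trans w≡ (cong (λ t → A ++ m ∷ t) R≡) , m∉A , m∉B , (λ m∈C → occ-∈ m C m∈C occ-C)
  where
  open Admissible adm
  m = minimum w
  m∈w = minimum-∈ w w≢[]
  A = proj₁ (cut m w)
  R = proj₂ (cut m w)
  w≡ = proj₁ (cut-∈ m w m∈w)
  m∉A = proj₂ (cut-∈ m w m∈w)
  occ-R : occ m R ≡ 1
  occ-R = suc-injective (trans (sym (occ-after-first m A R m∉A)) (trans (cong (occ m) (sym w≡)) (twice m∈w)))
  m∈R = occ-suc⇒∈ m R occ-R
  B = proj₁ (cut m R)
  C = proj₂ (cut m R)
  R≡ = proj₁ (cut-∈ m R m∈R)
  m∉B = proj₂ (cut-∈ m R m∈R)
  occ-C : occ m C ≡ 0
  occ-C = suc-injective (trans (sym (occ-after-first m B C m∉B)) (trans (cong (occ m) (sym R≡)) occ-R))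

record Blocks (lo m : ℕ) (A B C : List ℕ) : Set where
  field
    lo<m  : lo < m
    adm-A : Admissible m A
    adm-B : Admissible m B
    adm-C : Admissible m C
    A#B   : Disjoint A B
    A#C   : Disjoint A C
    B#C   : Disjoint B C

occ-blocks : ∀ x m A B C → x ≢ m → occ x (A ++ m ∷ B ++ m ∷ C) ≡ occ x A + (occ x B + occ x C)
occ-blocks x m A B C x≢m =
  trans (occ-++ x A _)
        (cong (occ x A +_) (trans (occ-there x m _ x≢m)
                                  (trans (occ-++ x B _) (cong (occ x B +_) (occ-there x m C x≢m)))))

-- In a Stirling word  A · m · B · m · C  with all letters ≥ m the blocks are
-- pairwise disjoint: a letter shared by two blocks is separated by an m, hence below m.
blocks-disjoint : ∀ m A B C → Stirling (A ++ m ∷ B ++ m ∷ C) → All (m ≤_) (A ++ m ∷ B ++ m ∷ C) →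
  Disjoint A B × Disjoint A C × Disjoint B C
blocks-disjoint m A B C stirling m≤W =
  (λ (x∈A , x∈B) → A#BmC (x∈A , ∈-++⁺ˡ x∈B)) ,
  (λ (x∈A , x∈C) → A#BmC (x∈A , ∈-++⁺ʳ B (there x∈C))) ,
  B#C
  where
  not-below : ∀ {x} → x ∈ A ++ m ∷ B ++ m ∷ C → x < m → ⊥
  not-below x∈ x<m = <-irrefl refl (≤-<-trans (All.lookup m≤W x∈) x<m)
  A#BmC : Disjoint A (B ++ m ∷ C)
  A#BmC (x∈A , x∈BmC) = not-below (∈-++⁺ˡ x∈A) (separated A m (B ++ m ∷ C) _ stirling x∈A x∈BmC)
  B#C : Disjoint B C
  B#C (x∈B , x∈C) = not-below (∈-++⁺ʳ A (there (∈-++⁺ˡ x∈B)))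
    (separated (A ++ m ∷ B) m C _ (subst Stirling (sym (++-assoc A (m ∷ B) (m ∷ C))) stirling)
               (∈-++⁺ʳ A (there x∈B)) x∈C)

twice-in-blocks : ∀ m A B C → (∀ {x} → x ∈ A ++ m ∷ B ++ m ∷ C → occ x (A ++ m ∷ B ++ m ∷ C) ≡ 2) →
  m ∉ A → m ∉ B → m ∉ C → Disjoint A B → Disjoint A C → Disjoint B C →
  (∀ {x} → x ∈ A → occ x A ≡ 2) × (∀ {x} → x ∈ B → occ x B ≡ 2) × (∀ {x} → x ∈ C → occ x C ≡ 2)
twice-in-blocks m A B C twice m∉A m∉B m∉C A#B A#C B#C = twice-A , twice-B , twice-C
  where
  open ≡-Reasoning
  total : ∀ {x X} → x ∈ A ++ m ∷ B ++ m ∷ C → x ∈ X → m ∉ X → occ x A + (occ x B + occ x C) ≡ 2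
  total {x} x∈W x∈X m∉X = trans (sym (occ-blocks x m A B C λ { refl → m∉X x∈X })) (twice x∈W)
  twice-A : ∀ {x} → x ∈ A → occ x A ≡ 2
  twice-A {x} x∈ = begin
    occ x A                         ≡⟨ +-identityʳ _ ⟨
    occ x A + (0 + 0)               ≡⟨ cong₂ (λ b c → occ x A + (b + c)) (occ-∉ x B (λ x∈B → A#B (x∈ , x∈B)))
                                                                       (occ-∉ x C (λ x∈C → A#C (x∈ , x∈C))) ⟨
    occ x A + (occ x B + occ x C)   ≡⟨ total (∈-++⁺ˡ x∈) x∈ m∉A ⟩
    2                               ∎
  twice-B : ∀ {x} → x ∈ B → occ x B ≡ 2
  twice-B {x} x∈ = begin
    occ x B                         ≡⟨ +-identityʳ _ ⟨
    0 + (occ x B + 0)               ≡⟨ cong₂ (λ a c → a + (occ x B + c)) (occ-∉ x A (λ x∈A → A#B (x∈A , x∈)))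
                                                                       (occ-∉ x C (λ x∈C → B#C (x∈ , x∈C))) ⟨
    occ x A + (occ x B + occ x C)   ≡⟨ total (∈-++⁺ʳ A (there (∈-++⁺ˡ x∈))) x∈ m∉B ⟩
    2                               ∎
  twice-C : ∀ {x} → x ∈ C → occ x C ≡ 2
  twice-C {x} x∈ = begin
    0 + (0 + occ x C)               ≡⟨ cong₂ (λ a b → a + (b + occ x C)) (occ-∉ x A (λ x∈A → A#C (x∈A , x∈)))
                                                                       (occ-∉ x B (λ x∈B → B#C (x∈B , x∈))) ⟨
    occ x A + (occ x B + occ x C)   ≡⟨ total (∈-++⁺ʳ A (there (∈-++⁺ʳ B (there x∈)))) x∈ m∉C ⟩
    2                               ∎

blocks : ∀ lo m A B C → Admissible lo (A ++ m ∷ B ++ m ∷ C) → m ∉ A → m ∉ B → m ∉ C →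
  All (m ≤_) (A ++ m ∷ B ++ m ∷ C) → Blocks lo m A B C
blocks lo m A B C adm m∉A m∉B m∉C m≤W = record
  { lo<m  = All.lookup above (∈-insert A)
  ; adm-A = record { stirling = Stirling-prefix A _ stirling ; twice = twice-A ; above = above-m ∈-++⁺ˡ m∉A }
  ; adm-B = record { stirling = Stirling-prefix B _ stir-BmC ; twice = twice-B
                   ; above = above-m (∈-++⁺ʳ A ∘ there ∘ ∈-++⁺ˡ) m∉B }
  ; adm-C = record { stirling = Stirling-suffix (m ∷ []) C (Stirling-suffix B _ stir-BmC) ; twice = twice-C
                   ; above = above-m (∈-++⁺ʳ A ∘ there ∘ ∈-++⁺ʳ B ∘ there) m∉C }
  ; A#B   = A#B
  ; A#C   = A#C
  ; B#C   = B#C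
  }
  where
  open Admissible adm
  A#B = proj₁ (blocks-disjoint m A B C stirling m≤W)
  A#C = proj₁ (proj₂ (blocks-disjoint m A B C stirling m≤W))
  B#C = proj₂ (proj₂ (blocks-disjoint m A B C stirling m≤W))
  twices = twice-in-blocks m A B C twice m∉A m∉B m∉C A#B A#C B#C
  twice-A = proj₁ twices
  twice-B = proj₁ (proj₂ twices)
  twice-C = proj₂ (proj₂ twices)
  stir-BmC : Stirling (B ++ m ∷ C)
  stir-BmC = Stirling-suffix (m ∷ []) _ (Stirling-suffix A _ stirling)
  above-m : ∀ {X} → (∀ {x} → x ∈ X → x ∈ A ++ m ∷ B ++ m ∷ C) → m ∉ X → All (m <_) X
  above-m inX m∉X = All.tabulate λ x∈ →
    ≤∧≢⇒< (All.lookup m≤W (inX x∈)) (λ m≡x → m∉X (subst (_∈ _) (sym m≡x) x∈))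

parse-good : ∀ k lo w → length w ≤ k → Admissible lo w → Good lo (parse k w) × word (parse k w) ≡ w
parse-good k       lo []      _   _ rewrite parse-[] k = tt , refl
parse-good zero    lo (x ∷ w) ()  _
parse-good (suc k) lo w@(_ ∷ _) ≤k adm
  with w≡ , m∉A , m∉B , m∉C ← split-at-minimum w adm (λ ()) =
  (lo<m , good-A , good-B , good-C ,
     subst₂ Disjoint (sym word-A) (sym word-B) A#B ,
     subst₂ Disjoint (sym word-A) (sym word-C) A#C ,
     subst₂ Disjoint (sym word-B) (sym word-C) B#C) ,
  trans (cong₃ (λ x y z → x ++ m ∷ y ++ m ∷ z) word-A word-B word-C) (sym w≡)
  where
  m = minimum w
  A = proj₁ (pieces w)
  B = proj₁ (proj₂ (pieces w))
  C = proj₂ (proj₂ (pieces w))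
  open Blocks (blocks lo m A B C (subst (Admissible lo) w≡ adm) m∉A m∉B m∉C
                      (subst (All (m ≤_)) w≡ (minimum-≤ w)))
  shorter = pieces-shorter A m B C (subst (λ v → length v ≤ suc k) w≡ ≤k)
  sub-A = parse-good k m A (proj₁ shorter) adm-A
  sub-B = parse-good k m B (proj₁ (proj₂ shorter)) adm-B
  sub-C = parse-good k m C (proj₂ (proj₂ shorter)) adm-C
  good-A = proj₁ sub-A
  good-B = proj₁ sub-B
  good-C = proj₁ sub-C
  word-A = proj₂ sub-A
  word-B = proj₂ sub-B
  word-C = proj₂ sub-C

isMultisetPerm-↭ : ∀ n {v w} → v ↭ w → isMultisetPerm n v ≡ isMultisetPerm n w
isMultisetPerm-↭ n v↭w =
  cong₂ _∧_ (cong (_≡ᵇ 2 * n) (Perm.↭-length v↭w)) (allᵇ-cong (λ i → cong (_≡ᵇ 2) (occ-↭ i v↭w)) [ 1 ⋯ n ])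

module Involution (n : ℕ) where

  ∈𝒬⁻ : ∀ {w} → w ∈ 𝒬 n → w ∈ words (2 * n) n × T (isMultisetPerm n w) × T (stirlingCond w)
  ∈𝒬⁻ w∈ = let w∈words , stirling = ∈-filter⁻ (T? ∘ isStirling n) w∈
           in w∈words , Equivalence.to T-∧ stirling

  ∈𝒬⁺ : ∀ {w} → w ∈ words (2 * n) n → T (isMultisetPerm n w) → T (stirlingCond w) → w ∈ 𝒬 n
  ∈𝒬⁺ w∈words multiset stirling = ∈-filter⁺ (T? ∘ isStirling n) w∈words (Equivalence.from T-∧ (multiset , stirling))

  -- Elements of 𝒬 n are admissible above 0: their letters lie in [1 ⋯ n].
  admissible : ∀ {w} → w ∈ 𝒬 n → Admissible 0 w
  admissible {w} w∈ = record
    { stirling = StirlingAt⇒Stirling w (stirlingCond⇒StirlingAt w stirling)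
    ; twice    = λ x∈ → ≡ᵇ⇒≡ _ 2 (allᵇ-lookup _ [ 1 ⋯ n ] (proj₂ (Equivalence.to T-∧ multiset))
                                                 (All.lookup letters x∈))
    ; above    = All.map positive letters
    }
    where
    w∈words = proj₁ (∈𝒬⁻ w∈)
    multiset = proj₁ (proj₂ (∈𝒬⁻ w∈))
    stirling = proj₂ (proj₂ (∈𝒬⁻ w∈))
    letters = proj₂ (∈-words⁻ (2 * n) n w∈words)
    positive : ∀ {x} → x ∈ [ 1 ⋯ n ] → 0 < x
    positive x∈ with _ , _ , refl ← ∈-applyUpTo⁻ suc x∈ = z<s

  𝒬-unique : Unique (𝒬 n)
  𝒬-unique = Unique.filter⁺ (T? ∘ isStirling n) (words-unique (2 * n) n)

  tree : List ℕ → Tree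
  tree w = parse (length w) w

  tree-good : ∀ {w} → w ∈ 𝒬 n → Good 0 (tree w) × word (tree w) ≡ w
  tree-good {w} w∈ = parse-good (length w) 0 w ≤-refl (admissible w∈)

  φ : List ℕ → List ℕ
  φ w = word (swap (tree w))

  φ-↭ : ∀ {w} → w ∈ 𝒬 n → φ w ↭ w
  φ-↭ {w} w∈ = ↭-trans (word-swap (tree w)) (↭-reflexive (proj₂ (tree-good w∈)))

  φ-closed : ∀ {w} → w ∈ 𝒬 n → φ w ∈ 𝒬 n
  φ-closed {w} w∈ =
    ∈𝒬⁺ (∈-words⁺ (2 * n) n (trans (Perm.↭-length (φ-↭ w∈)) length≡)
                             (Perm.All-resp-↭ (↭-sym (φ-↭ w∈)) letters))
        (subst T (sym (isMultisetPerm-↭ n (φ-↭ w∈))) (proj₁ (proj₂ (∈𝒬⁻ w∈))))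
        (StirlingAt⇒stirlingCond (φ w) (Stirling⇒StirlingAt (φ w)
          (Stirling-word 0 (swap (tree w)) (Good-swap 0 (tree w) (proj₁ (tree-good w∈))))))
    where
    length≡ = proj₁ (∈-words⁻ (2 * n) n (proj₁ (∈𝒬⁻ w∈)))
    letters = proj₂ (∈-words⁻ (2 * n) n (proj₁ (∈𝒬⁻ w∈)))

  tree-φ : ∀ {w} → w ∈ 𝒬 n → tree (φ w) ≡ swap (tree w)
  tree-φ {w} w∈ = parse-word 0 (swap (tree w)) _
    (Good⇒Increasing 0 _ (Good-swap 0 (tree w) (proj₁ (tree-good w∈)))) ≤-refl

  φ-involutive : ∀ {w} → w ∈ 𝒬 n → φ (φ w) ≡ w
  φ-involutive {w} w∈ = begin
    word (swap (tree (φ w)))    ≡⟨ cong (word ∘ swap) (tree-φ w∈) ⟩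
    word (swap (swap (tree w))) ≡⟨ cong word (swap-involutive (tree w)) ⟩
    word (tree w)               ≡⟨ proj₂ (tree-good w∈) ⟩
    w                           ∎
    where open ≡-Reasoning

  windows-φ : ∀ {f f′ first first′ second} → ShapeDetermined f first second → ShapeDetermined f′ first′ second →
    (∀ a b → first′ a b ≡ first b a) → ∀ {w} → w ∈ 𝒬 n → windows f 0 (φ w) ≡ windows f′ 0 w
  windows-φ {f} {f′} {first} {first′} {second} S S′ exchanged {w} w∈ = begin
    windows f 0 (word (swap (tree w)))                                  ≡⟨ windows-tree S 0 (swap (tree w)) increasing′ ⟩
    nodeSum (shapeWeight first second) (swap (tree w))                  ≡⟨ nodeSum-swap _ (tree w) ⟩
    nodeSum (λ a b c → shapeWeight first second b a c) (tree w)         ≡⟨ nodeSum-cong (λ a b c → cong (λ x → ones x + ones (not c ∧ second)) (sym (exchanged a b))) (tree w) ⟩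
    nodeSum (shapeWeight first′ second) (tree w)                        ≡⟨ windows-tree S′ 0 (tree w) increasing ⟨
    windows f′ 0 (word (tree w))                                        ≡⟨ cong (windows f′ 0) (proj₂ (tree-good w∈)) ⟩
    windows f′ 0 w                                                      ∎
    where
    open ≡-Reasoning
    good = proj₁ (tree-good w∈)
    increasing = Good⇒Increasing 0 (tree w) good
    increasing′ = Good⇒Increasing 0 (swap (tree w)) (Good-swap 0 (tree w) good)

  lap-φ : ∀ {w} → w ∈ 𝒬 n → lap (φ w) ≡ lap w
  lap-φ {w} w∈ = trans (lap-windows (φ w))
    (trans (windows-φ lap-shape lap-shape ∧-comm w∈) (sym (lap-windows w)))

  dasc-φ : ∀ {w} → w ∈ 𝒬 n → dasc (φ w) ≡ dp w
  dasc-φ {w} w∈ = trans (dasc-windows (φ w))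
    (trans (windows-φ dasc-shape dp-shape (λ a b → ∧-comm (not a) b) w∈) (sym (dp-windows w)))

  dp-φ : ∀ {w} → w ∈ 𝒬 n → dp (φ w) ≡ dasc w
  dp-φ {w} w∈ = trans (dp-windows (φ w))
    (trans (windows-φ dp-shape dasc-shape (λ a b → ∧-comm a (not b)) w∈) (sym (dasc-windows w)))

  asc-φ : ∀ {w} → w ∈ 𝒬 n → w ≢ [] → asc (φ w) ≡ plat w
  asc-φ {w} w∈ w≢[] = begin
    asc (φ w)                                                              ≡⟨ asc-windows (φ w) φw≢[] ⟩
    1 + windows ascᶠ 0 (word (swap (tree w)))                              ≡⟨ cong (1 +_) (windows-tree asc-shape 0 (swap (tree w)) increasing′) ⟩
    1 + nodeSum (shapeWeight (λ a b → not b) true) (swap (tree w))         ≡⟨ cong₂ _+_ (sym root-counted) (nodeSum-swap _ (tree w)) ⟩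
    ones (not (isLeaf (tree w)))
      + nodeSum (λ a b c → shapeWeight (λ a b → not b) true b a c) (tree w) ≡⟨ rises-vs-plateaus (tree w) ⟩
    nodeSum (shapeWeight (λ a b → b) false) (tree w)                       ≡⟨ windows-tree plat-shape 0 (tree w) increasing ⟨
    windows platᶠ 0 (word (tree w))                                        ≡⟨ cong (windows platᶠ 0) (proj₂ (tree-good w∈)) ⟩
    windows platᶠ 0 w                                                      ≡⟨ plat-windows w ⟨
    plat w                                                                 ∎
    where
    open ≡-Reasoning
    good = proj₁ (tree-good w∈)
    increasing = Good⇒Increasing 0 (tree w) good
    increasing′ = Good⇒Increasing 0 (swap (tree w)) (Good-swap 0 (tree w) good)
    φw≢[] : φ w ≢ []
    φw≢[] φw≡[] = w≢[] (Perm.↭-empty-inv (subst (w ↭_) φw≡[] (↭-sym (φ-↭ w∈))))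
    root-counted : ones (not (isLeaf (tree w))) ≡ 1
    root-counted with tree w | proj₂ (tree-good w∈)
    ... | leaf         | []≡w = ⊥-elim (w≢[] (sym []≡w))
    ... | node _ _ _ _ | _    = refl

  nonempty : 1 ≤ n → ∀ {w} → w ∈ 𝒬 n → w ≢ []
  nonempty 1≤n w∈ refl =
    n≮0 (subst (1 ≤_) (sym (proj₁ (∈-words⁻ (2 * n) n (proj₁ (∈𝒬⁻ w∈))))) (≤-trans 1≤n (m≤m+n n (n + 0))))

  lap-dasc-dp-symmetric : (a b c : ℕ) → P-coeff n a b c ≡ P-coeff n a c b
  lap-dasc-dp-symmetric a b c =
    count-involution (𝒬 n) φ _ _ 𝒬-unique φ-closed φ-involutive transfer
    where
    transfer : ∀ {w} → w ∈ 𝒬 n →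
      ((lap (φ w) ≡ᵇ a) ∧ (dasc (φ w) ≡ᵇ c) ∧ (dp (φ w) ≡ᵇ b)) ≡ ((lap w ≡ᵇ a) ∧ (dasc w ≡ᵇ b) ∧ (dp w ≡ᵇ c))
    transfer {w} w∈ rewrite lap-φ w∈ | dasc-φ w∈ | dp-φ w∈ =
      cong ((lap w ≡ᵇ a) ∧_) (∧-comm (dp w ≡ᵇ c) (dasc w ≡ᵇ b))

  lap-asc-plat : 1 ≤ n → (a b : ℕ) → LapAsc-coeff n a b ≡ LapPlat-coeff n a b
  lap-asc-plat 1≤n a b =
    sym (count-involution (𝒬 n) φ _ _ 𝒬-unique φ-closed φ-involutive transfer)
    where
    transfer : ∀ {w} → w ∈ 𝒬 n → ((lap (φ w) ≡ᵇ a) ∧ (asc (φ w) ≡ᵇ b)) ≡ ((lap w ≡ᵇ a) ∧ (plat w ≡ᵇ b))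
    transfer w∈ rewrite lap-φ w∈ | asc-φ w∈ (nonempty 1≤n w∈) = refl

mainTheorem2 : (n : ℕ) → 1 ≤ n →
    ((a b c : ℕ) → P-coeff n a b c ≡ P-coeff n a c b)
    × ((a b : ℕ) → LapAsc-coeff n a b ≡ LapPlat-coeff n a b)
mainTheorem2 n 1≤n = lap-dasc-dp-symmetric , lap-asc-plat 1≤n
  where open Involution n
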